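{- Let $k\ge 0$, $n\ge 1$, $\ell\ge 3$, $m\ge 1$, let $\psi$ be a sentence in $\mathsf{C}^{\mathrm{w}}_\ell$ and let $\phi(x_1,\ldots,x_k,y)\in\mathsf{C}^{\mathrm{w}}_m$. Then there is a formula $\tilde\psi(x_1,\ldots,x_k,y)\in\mathsf{C}^{\mathrm{w}}_{\max\{k+\ell,m\}}$ such that for all graphs $G$ of order $|G|\le n$ and all $u_1,\ldots,u_k,v\in V(G)$ the following holds: letting $U\coloneqq\phi[G,u_1,\ldots,u_k,y]$ and, if $v\notin U$, letting $A_v$ be the connected component of $v$ in $G\setminus U$, we have $G\models\tilde\psi(u_1,\ldots,u_k,v)$ if and only if $v\notin U$ and $A_v\models\psi$.
   Context: Graphs are finite, simple, undirected, possibly arc-coloured (a colour relation $R_c$ per colour plus the edge relation $E$). $\mathsf{C}$ is first-order logic with counting quantifiers $\exists^{\ge p}x$ ($p\ge1$); atomic formulae $x=y$, $E(x,y)$, $R_c(x,y)$; connectives $\neg,\vee$. A formula has width $k$ if each subformula has at most $k$ free variables; $\mathsf{C}^{\mathrm{w}}_k$ denotes the $\mathsf{C}$-formulae of width at most $k$. $\phi(x_1,\dots,x_k,y)$ means the free variables are among those listed. $\phi[G,u_1,\ldots,u_k,y]$ denotes the set of $w\in V(G)$ with $G\models\phi(u_1,\ldots,u_k,w)$. $G\setminus U$ is the subgraph induced on $V(G)\setminus U$. -}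

module Defs where

open import Data.Nat using (ℕ; zero; suc; _≤_; _<_; _<?_; _≤ᵇ_; _≡ᵇ_)
open import Data.Fin using (Fin; zero; suc; fromℕ<)
open import Data.Bool using (Bool; true; false; if_then_else_; _∨_; not; T)
open import Data.List using (List; length)
open import Data.List.Membership.Propositional using (_∈_)
open import Data.Product using (Σ; _×_; _,_)
open import Data.Empty using (⊥)
open import Relation.Nullary using (¬_; yes; no; does)
open import Data.Fin using (_≟_)
open import Relation.Binary.PropositionalEquality using (_≡_; sym)

record Graph (C : ℕ) : Set where
  field
    N     : ℕ
    E     : Fin N → Fin N → Bool
    E-sym : ∀ i j → E i j ≡ E j i
    E-irr : ∀ i → E i i ≡ false
    R     : Fin C → Fin N → Fin N → Bool

open Graph public

V : ∀ {C} → Graph C → Set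
V G = Fin (N G)

-- Induced subgraph on a decidable vertex set A : Fin N → Bool.
-- Its vertices are enumerated in increasing order by `emb`.

sizeAux : Bool → ℕ → ℕ
sizeAux true  s = suc s
sizeAux false s = s

size : ∀ {N} → (Fin N → Bool) → ℕ
size {zero}  A = 0
size {suc N} A = sizeAux (A zero) (size (λ i → A (suc i)))

embAux : ∀ {N s} (b : Bool) → (Fin s → Fin N) → Fin (sizeAux b s) → Fin (suc N)
embAux true  f zero    = zero
embAux true  f (suc i) = suc (f i)
embAux false f i       = suc (f i)

emb : ∀ {N} (A : Fin N → Bool) → Fin (size A) → Fin N
emb {zero}  A ()
emb {suc N} A = embAux (A zero) (emb (λ i → A (suc i)))

induced : ∀ {C} (G : Graph C) → (V G → Bool) → Graph C
induced G A = record
  { N     = size A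
  ; E     = λ i j → E G (emb A i) (emb A j)
  ; E-sym = λ i j → E-sym G (emb A i) (emb A j)
  ; E-irr = λ i → E-irr G (emb A i)
  ; R     = λ c i j → R G c (emb A i) (emb A j)
  }

Var : Set
Var = ℕ

data Fm (C : ℕ) : Set where
  eq   : Var → Var → Fm C
  edge : Var → Var → Fm C
  col  : Fin C → Var → Var → Fm C
  neg  : Fm C → Fm C
  or   : Fm C → Fm C → Fm C
  cnt  : (q : ℕ) → Var → Fm C → Fm C      -- ∃^{≥ (1+q)} x φ  (so p = 1+q ≥ 1)

data Free {C : ℕ} : Fm C → Var → Set where
  eq₁   : ∀ {x y} → Free (eq x y) x
  eq₂   : ∀ {x y} → Free (eq x y) y
  edge₁ : ∀ {x y} → Free (edge x y) x
  edge₂ : ∀ {x y} → Free (edge x y) y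
  col₁  : ∀ {c x y} → Free (col c x y) x
  col₂  : ∀ {c x y} → Free (col c x y) y
  neg′  : ∀ {φ z} → Free φ z → Free (neg φ) z
  orˡ   : ∀ {φ ψ z} → Free φ z → Free (or φ ψ) z
  orʳ   : ∀ {φ ψ z} → Free ψ z → Free (or φ ψ) z
  cnt′  : ∀ {q x φ z} → Free φ z → ¬ (z ≡ x) → Free (cnt q x φ) z

FreeBound : ∀ {C} → ℕ → Fm C → Set
FreeBound k φ = Σ (List Var) λ L → length L ≤ k × (∀ z → Free φ z → z ∈ L)

Width : ∀ {C} → ℕ → Fm C → Set
Width k φ@(eq _ _)     = FreeBound k φ
Width k φ@(edge _ _)   = FreeBound k φ
Width k φ@(col _ _ _)  = FreeBound k φ
Width k φ@(neg ψ)      = FreeBound k φ × Width k ψ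
Width k φ@(or ψ χ)     = FreeBound k φ × Width k ψ × Width k χ
Width k φ@(cnt _ _ ψ)  = FreeBound k φ × Width k ψ

Sentence : ∀ {C} → Fm C → Set
Sentence φ = ∀ z → ¬ Free φ z

-- free variables among x₁..x_k, y, encoded as variables 0..k-1 and k.
FreeAmong : ∀ {C} → ℕ → Fm C → Set
FreeAmong j φ = ∀ z → Free φ z → z < j

count : ∀ {N} → (Fin N → Bool) → ℕ
count {zero}  f = 0
count {suc N} f = (if f zero then 1 else 0) Data.Nat.+ count (λ i → f (suc i))

update : ∀ {A : Set} → (Var → A) → Var → A → (Var → A)
update ρ x a z = if z ≡ᵇ x then a else ρ z

sat : ∀ {C} (G : Graph C) → (Var → V G) → Fm C → Bool
sat G ρ (eq x y)    = does (ρ x ≟ ρ y)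
sat G ρ (edge x y)  = E G (ρ x) (ρ y)
sat G ρ (col c x y) = R G c (ρ x) (ρ y)
sat G ρ (neg φ)     = not (sat G ρ φ)
sat G ρ (or φ ψ)    = sat G ρ φ ∨ sat G ρ ψ
sat G ρ (cnt q x φ) = suc q ≤ᵇ count (λ w → sat G (update ρ x w) φ)

-- assignment x_i ↦ u_i (variable i-1 for i = 1..k), y ↦ v (variable k);
-- other variables (never free in the relevant formulas) also ↦ v.
env : ∀ {A : Set} (k : ℕ) → (Fin k → A) → A → (Var → A)
env k u v z with z <? k
... | yes p = u (fromℕ< p)
... | no _  = v

Holds : ∀ {C} (G : Graph C) (k : ℕ) → Fm C → (Fin k → V G) → V G → Set
Holds G k φ u v = T (sat G (env k u v) φ)

data Walk {C} (G : Graph C) (S : V G → Set) (v : V G) : V G → Set where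
  here : S v → Walk G S v v
  step : ∀ {w w′} → Walk G S v w → S w′ → T (E G w w′) → Walk G S v w′

IsComponent : ∀ {C} (G : Graph C) (S : V G → Set) (v : V G) (A : V G → Bool) → Set
IsComponent G S v A = ∀ w → (T (A w) → Walk G S v w) × (Walk G S v w → T (A w))

-- G ⊨ ψ for a sentence ψ (truth value is independent of the assignment;
-- only applied below to nonempty graphs)
Models : ∀ {C} (G : Graph C) → Fm C → Set
Models G ψ = ∀ (ρ : Var → V G) → T (sat G ρ ψ)

module Submission where

-- Fix the layout x_i ↦ i, y ↦ k, a scratch variable s = k+1, and
-- z ↦ tr z = k+2+z for the variables of ψ.  First, connectivity: a
-- breadth-first search outside U saturates after |G| ≤ n rounds
-- (`Saturation`, `Reachability`), and each round is expressible with the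
-- three variables a, b, s (`Guards.reach`), so "a ∈ component of b" is a
-- formula of width k+3 ≤ k+ℓ.  Then ψ is translated (`Relativisation.Tr`)
-- by guarding every counting quantifier ∃^{≥p} z θ with "tr z lies in the
-- component of an anchor": a free variable of the quantified formula, or y
-- if it is closed.  Closed subformulas are hoisted into tests of a decision
-- tree, so that the anchor y never adds a variable to a formula of width
-- k+ℓ.

open import Defs
open import Data.Nat using (ℕ; zero; suc; _≤_; _<_; _+_; _∸_; _⊔_; _<ᵇ_; _≤ᵇ_; _≡ᵇ_; z≤n; s≤s; _<?_)
import Data.Nat.Properties as ℕP
open import Data.Fin using (Fin; zero; suc; _≟_; fromℕ<)
import Data.Fin.Properties as FinP
open import Data.Bool using (Bool; true; false; if_then_else_; _∨_; _∧_; not; T)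
import Data.Bool.Properties as BoolP
open import Data.Product using (Σ; _×_; _,_; proj₁; proj₂; ∃)
open import Data.Sum using (_⊎_; inj₁; inj₂)
open import Data.Empty using (⊥-elim)
open import Data.Unit using (⊤; tt)
open import Data.List using (List; []; _∷_; length; upTo; _++_; map; filter)
import Data.List.Properties as ListP
open import Data.List.Membership.Propositional using (_∈_)
open import Data.List.Membership.Propositional.Properties
  using (∈-upTo⁺; ∈-upTo⁻; ∈-map⁺; ∈-++⁺ˡ; ∈-++⁺ʳ; ∈-++⁻; ∈-filter⁺; ∈-filter⁻)
open import Data.List.Membership.DecPropositional ℕP._≟_ using (_∈?_)
open import Data.List.Relation.Unary.Any using (here; there)
open import Data.List.Relation.Binary.Subset.Propositional using (_⊆_)
open import Data.List.Relation.Binary.Subset.Propositional.Properties using (xs⊆x∷xs; ∷⁺ʳ)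
open import Relation.Nullary using (¬_; Dec; yes; no; does; ¬?)
open import Relation.Nullary.Decidable using (dec-true; map′)
open import Relation.Binary.PropositionalEquality
open import Function.Base using (_∘_; case_of_)
open import Function.Bundles using (_⇔_; mk⇔; Equivalence)

T-ext : ∀ {a b : Bool} → (T a → T b) → (T b → T a) → a ≡ b
T-ext {false} {false} _ _ = refl
T-ext {false} {true}  _ g = ⊥-elim (g tt)
T-ext {true}  {false} f _ = ⊥-elim (f tt)
T-ext {true}  {true}  _ _ = refl

T-∧⁻ : ∀ {a b} → T (a ∧ b) → T a × T b
T-∧⁻ = Equivalence.to BoolP.T-∧

T-∧⁺ : ∀ {a b} → T a → T b → T (a ∧ b)
T-∧⁺ x y = Equivalence.from BoolP.T-∧ (x , y)

T-∨⁻ : ∀ {a b} → T (a ∨ b) → T a ⊎ T b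
T-∨⁻ = Equivalence.to BoolP.T-∨

T-∨⁺ : ∀ {a b} → T a ⊎ T b → T (a ∨ b)
T-∨⁺ = Equivalence.from BoolP.T-∨

T-not⁻ : ∀ {b} → T (not b) → ¬ T b
T-not⁻ {true} ()

T-not⁺ : ∀ {b} → ¬ T b → T (not b)
T-not⁺ {false} _ = tt
T-not⁺ {true}  h = h tt

≟-self : ∀ {N} (r : Fin N) → T (does (r ≟ r))
≟-self r = subst T (sym (dec-true (r ≟ r) refl)) tt

bit : Bool → ℕ
bit b = if b then 1 else 0

0<ᵇbit : ∀ b → (0 <ᵇ bit b) ≡ b
0<ᵇbit true  = refl
0<ᵇbit false = refl

count-cong : ∀ {N} {f g : Fin N → Bool} → (∀ i → f i ≡ g i) → count f ≡ count g
count-cong {zero}  _ = refl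
count-cong {suc N} {f} {g} f≗g rewrite f≗g zero =
  cong (bit (g zero) +_) (count-cong (λ i → f≗g (suc i)))

count-false : ∀ N → count {N} (λ _ → false) ≡ 0
count-false zero    = refl
count-false (suc N) = count-false N

count-true : ∀ N → count {N} (λ _ → true) ≡ N
count-true zero    = refl
count-true (suc N) = cong suc (count-true N)

count-≤ : ∀ {N} (f : Fin N → Bool) → count f ≤ N
count-≤ {zero}  f = z≤n
count-≤ {suc N} f with f zero
... | true  = s≤s (count-≤ (λ i → f (suc i)))
... | false = ℕP.m≤n⇒m≤1+n (count-≤ (λ i → f (suc i)))

count-mono : ∀ {N} (f g : Fin N → Bool) → (∀ i → T (f i) → T (g i)) → count f ≤ count g
count-mono {zero}  f g f⊆g = z≤n
count-mono {suc N} f g f⊆g with f zero | g zero | f⊆g zero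
... | true  | true  | _ = s≤s (count-mono _ _ (λ i → f⊆g (suc i)))
... | true  | false | h = ⊥-elim (h tt)
... | false | true  | _ = ℕP.m≤n⇒m≤1+n (count-mono _ _ (λ i → f⊆g (suc i)))
... | false | false | _ = count-mono _ _ (λ i → f⊆g (suc i))

count-strict : ∀ {N} (f g : Fin N → Bool) → (∀ i → T (f i) → T (g i)) →
  ∀ j → T (g j) → ¬ T (f j) → suc (count f) ≤ count g
count-strict {suc N} f g f⊆g zero gj ¬fj with f zero | g zero | f⊆g zero
... | true  | _     | _ = ⊥-elim (¬fj tt)
... | false | false | _ = ⊥-elim gj
... | false | true  | _ = s≤s (count-mono _ _ (λ i → f⊆g (suc i)))
count-strict {suc N} f g f⊆g (suc j) gj ¬fj with f zero | g zero | f⊆g zero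
... | true  | true  | _ = s≤s (count-strict _ _ (λ i → f⊆g (suc i)) j gj ¬fj)
... | true  | false | h = ⊥-elim (h tt)
... | false | true  | _ = ℕP.m≤n⇒m≤1+n (count-strict _ _ (λ i → f⊆g (suc i)) j gj ¬fj)
... | false | false | _ = count-strict _ _ (λ i → f⊆g (suc i)) j gj ¬fj

count-single : ∀ {N} (t : Fin N) (g : Fin N → Bool) →
  count (λ w → does (w ≟ t) ∧ g w) ≡ bit (g t)
count-single {suc N} zero g = begin
  bit (g zero) + count {N} (λ _ → false) ≡⟨ cong (bit (g zero) +_) (count-false N) ⟩
  bit (g zero) + 0                       ≡⟨ ℕP.+-identityʳ _ ⟩
  bit (g zero)                           ∎
  where open ≡-Reasoning
count-single {suc N} (suc t) g = count-single t (λ i → g (suc i))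

count-pos⁻ : ∀ {N} (f : Fin N → Bool) → T (0 <ᵇ count f) → ∃ λ i → T (f i)
count-pos⁻ {suc N} f pos with f zero in fz
... | true  = zero , subst T (sym fz) tt
... | false with count-pos⁻ (λ i → f (suc i)) pos
...   | i , fi = suc i , fi

count-pos⁺ : ∀ {N} (f : Fin N → Bool) i → T (f i) → T (0 <ᵇ count f)
count-pos⁺ f i fi = ℕP.<⇒<ᵇ (ℕP.≤-trans one≤ (count-mono _ f (λ j → proj₂ ∘ T-∧⁻)))
  where
  one≤ : 1 ≤ count (λ j → does (j ≟ i) ∧ f j)
  one≤ rewrite count-single i f | Equivalence.to BoolP.T-≡ fi = ℕP.≤-refl

emb-in : ∀ {N} (A : Fin N → Bool) (i : Fin (size A)) → T (A (emb A i))
emb-in {suc N} A i with A zero in a0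
emb-in {suc N} A zero    | true  = subst T (sym a0) tt
emb-in {suc N} A (suc i) | true  = emb-in (λ j → A (suc j)) i
emb-in {suc N} A i       | false = emb-in (λ j → A (suc j)) i

emb-onto : ∀ {N} (A : Fin N → Bool) (w : Fin N) → T (A w) → ∃ λ i → emb A i ≡ w
emb-onto {suc N} A w Aw with A zero in a0
emb-onto {suc N} A zero Aw | true = zero , refl
emb-onto {suc N} A (suc w) Aw | true with emb-onto (λ j → A (suc j)) w Aw
... | i , e = suc i , cong suc e
emb-onto {suc N} A zero Aw | false = ⊥-elim (subst T a0 Aw)
emb-onto {suc N} A (suc w) Aw | false with emb-onto (λ j → A (suc j)) w Aw
... | i , e = i , cong suc e

emb-injective : ∀ {N} (A : Fin N → Bool) (i j : Fin (size A)) → emb A i ≡ emb A j → i ≡ j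
emb-injective {suc N} A i j e with A zero
emb-injective {suc N} A zero zero e       | true = refl
emb-injective {suc N} A (suc i) (suc j) e | true =
  cong suc (emb-injective (λ l → A (suc l)) i j (FinP.suc-injective e))
emb-injective {suc N} A i j e | false = emb-injective (λ l → A (suc l)) i j (FinP.suc-injective e)

emb-≟ : ∀ {N} (A : Fin N → Bool) (i j : Fin (size A)) → does (emb A i ≟ emb A j) ≡ does (i ≟ j)
emb-≟ A i j with emb A i ≟ emb A j | i ≟ j
... | yes _  | yes _    = refl
... | yes e  | no i≢j   = ⊥-elim (i≢j (emb-injective A i j e))
... | no e≢  | yes refl = ⊥-elim (e≢ refl)
... | no _   | no _     = refl

count-emb : ∀ {N} (A g : Fin N → Bool) → count (λ i → g (emb A i)) ≡ count (λ w → A w ∧ g w)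
count-emb {zero}  A g = refl
count-emb {suc N} A g with A zero
... | true  = cong (bit (g zero) +_) (count-emb (λ j → A (suc j)) (λ j → g (suc j)))
... | false = count-emb (λ j → A (suc j)) (λ j → g (suc j))

size≡count : ∀ {N} (A : Fin N → Bool) → size A ≡ count A
size≡count A = begin
  size A                             ≡⟨ sym (count-true (size A)) ⟩
  count {size A} (λ _ → true)        ≡⟨ count-emb A (λ _ → true) ⟩
  count (λ w → A w ∧ true)           ≡⟨ count-cong (λ w → BoolP.∧-identityʳ (A w)) ⟩
  count A                            ∎
  where open ≡-Reasoning

threshold-const : ∀ q {N} (A : Fin N → Bool) B →
  ((suc q ≤ᵇ count A) ∧ B) ≡ (suc q ≤ᵇ count {size A} (λ _ → B))
threshold-const q A true = begin
  (suc q ≤ᵇ count A) ∧ true          ≡⟨ BoolP.∧-identityʳ _ ⟩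
  suc q ≤ᵇ count A                   ≡⟨ cong (suc q ≤ᵇ_) (sym (size≡count A)) ⟩
  suc q ≤ᵇ size A                    ≡⟨ cong (suc q ≤ᵇ_) (sym (count-true (size A))) ⟩
  suc q ≤ᵇ count {size A} (λ _ → true) ∎
  where open ≡-Reasoning
threshold-const q A false = begin
  (suc q ≤ᵇ count A) ∧ false          ≡⟨ BoolP.∧-zeroʳ _ ⟩
  false                               ≡⟨ cong (suc q ≤ᵇ_) (sym (count-false (size A))) ⟩
  suc q ≤ᵇ count {size A} (λ _ → false) ∎
  where open ≡-Reasoning

update-same : ∀ {A : Set} (ρ : Var → A) x a → update ρ x a x ≡ a
update-same ρ x a rewrite Equivalence.to BoolP.T-≡ (ℕP.≡⇒≡ᵇ x x refl) = refl

update-other : ∀ {A : Set} (ρ : Var → A) x a z → ¬ z ≡ x → update ρ x a z ≡ ρ z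
update-other ρ x a z z≢x with z ≡ᵇ x in e
... | true  = ⊥-elim (z≢x (ℕP.≡ᵇ⇒≡ z x (subst T (sym e) tt)))
... | false = refl

update-agree : ∀ {A : Set} (ρ ρ′ : Var → A) x a z →
  (¬ z ≡ x → ρ z ≡ ρ′ z) → update ρ x a z ≡ update ρ′ x a z
update-agree ρ ρ′ x a z agree with z ℕP.≟ x
... | yes refl = trans (update-same ρ z a) (sym (update-same ρ′ z a))
... | no z≢x   = trans (update-other ρ x a z z≢x) (trans (agree z≢x) (sym (update-other ρ′ x a z z≢x)))

sat-coinc : ∀ {C} (G : Graph C) (θ : Fm C) (ρ ρ′ : Var → V G) →
  (∀ z → Free θ z → ρ z ≡ ρ′ z) → sat G ρ θ ≡ sat G ρ′ θ
sat-coinc G (eq x y)    ρ ρ′ h rewrite h x eq₁ | h y eq₂ = refl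
sat-coinc G (edge x y)  ρ ρ′ h rewrite h x edge₁ | h y edge₂ = refl
sat-coinc G (col c x y) ρ ρ′ h rewrite h x col₁ | h y col₂ = refl
sat-coinc G (neg θ)     ρ ρ′ h = cong not (sat-coinc G θ ρ ρ′ (λ z → h z ∘ neg′))
sat-coinc G (or θ θ′)   ρ ρ′ h =
  cong₂ _∨_ (sat-coinc G θ ρ ρ′ (λ z → h z ∘ orˡ)) (sat-coinc G θ′ ρ ρ′ (λ z → h z ∘ orʳ))
sat-coinc G (cnt q x θ) ρ ρ′ h = cong (suc q ≤ᵇ_) (count-cong λ w →
  sat-coinc G θ _ _ (λ z fz → update-agree ρ ρ′ x w z (h z ∘ cnt′ fz)))

-- Saturation: iterating an inflationary, extensional operator F on subsets
-- of an N-element set becomes stationary after at most N rounds, so every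
-- vertex reached at some round is already reached at any round n ≥ N.
module Saturation {N : ℕ} (F : (Fin N → Bool) → Fin N → Bool)
    (F-cong : ∀ {f g} → (∀ i → f i ≡ g i) → ∀ i → F f i ≡ F g i)
    (F-infl : ∀ f i → T (f i) → T (F f i)) where

  iter : ℕ → (Fin N → Bool) → Fin N → Bool
  iter zero    X = X
  iter (suc d) X = F (iter d X)

  iter-grows : ∀ X j d i → T (iter d X i) → T (iter (j + d) X i)
  iter-grows X zero    d i x = x
  iter-grows X (suc j) d i x = F-infl _ i (iter-grows X j d i x)

  Stable : (Fin N → Bool) → Set
  Stable f = ∀ i → F f i ≡ f i

  stable-forever : ∀ X e → Stable (iter e X) → ∀ j i → iter (j + e) X i ≡ iter e X i
  stable-forever X e st zero    i = refl
  stable-forever X e st (suc j) i = trans (F-cong (stable-forever X e st j) i) (st i)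

  progress : ∀ X d → (∃ λ e → e < d × Stable (iter e X)) ⊎ d ≤ count (iter d X)
  progress X zero = inj₂ z≤n
  progress X (suc d) with progress X d
  ... | inj₁ (e , e<d , st) = inj₁ (e , ℕP.m≤n⇒m≤1+n e<d , st)
  ... | inj₂ d≤ with FinP.all? (λ i → F (iter d X) i BoolP.≟ iter d X i)
  ...   | yes st = inj₁ (d , ℕP.≤-refl , st)
  ...   | no ¬st with FinP.¬∀⟶∃¬ N _ (λ i → F (iter d X) i BoolP.≟ iter d X i) ¬st
  ...     | i , changed = inj₂ (ℕP.≤-trans (s≤s d≤)
              (count-strict _ _ (F-infl _) i new (new⇒¬old changed new)))
    where
    new⇒¬old : ∀ {a b : Bool} → ¬ a ≡ b → T a → ¬ T b
    new⇒¬old {true} {true} a≢b _ _ = a≢b refl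
    new : T (F (iter d X) i)
    new with F (iter d X) i | iter d X i | F-infl (iter d X) i
    ... | true  | _     | _ = tt
    ... | false | false | _ = changed refl
    ... | false | true  | h = h tt

  -- As count ≤ N, some iterate up to round N is stable.
  stabilises : ∀ X → ∃ λ e → e ≤ N × Stable (iter e X)
  stabilises X with progress X (suc N)
  ... | inj₁ (e , s≤s e≤N , st) = e , e≤N , st
  ... | inj₂ N<count = ⊥-elim (ℕP.<-irrefl refl (ℕP.≤-trans N<count (count-≤ _)))

  saturated : ∀ X n → N ≤ n → ∀ d i → T (iter d X i) → T (iter n X i)
  saturated X n N≤n d i x with stabilises X
  ... | e , e≤N , st = subst T (trans (stable-at (n + d) e≤n+d) (sym (stable-at n e≤n))) late
    where
    e≤n : e ≤ n
    e≤n = ℕP.≤-trans e≤N N≤n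
    e≤n+d : e ≤ n + d
    e≤n+d = ℕP.≤-trans e≤n (ℕP.m≤m+n n d)
    stable-at : ∀ m → e ≤ m → iter m X i ≡ iter e X i
    stable-at m e≤m = trans (cong (λ l → iter l X i) (sym (ℕP.m∸n+n≡m e≤m)))
                            (stable-forever X e st (m ∸ e) i)
    late : T (iter (n + d) X i)
    late = iter-grows X n d i x

module Walks {C} (G : Graph C) {S : V G → Set} where

  walk-append : ∀ {a b c} → Walk G S a b → Walk G S b c → Walk G S a c
  walk-append p (here _)     = p
  walk-append p (step q s e) = step (walk-append p q) s e

  walk-cons : ∀ {a b c} → S a → T (E G a b) → Walk G S b c → Walk G S a c
  walk-cons sa e (here sb)     = step (here sa) sb e
  walk-cons sa e (step q s e′) = step (walk-cons sa e q) s e′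

  walk-reverse : ∀ {a b} → Walk G S a b → Walk G S b a
  walk-reverse (here s) = here s
  walk-reverse (step {w} {w′} p s e) = walk-cons s (subst T (E-sym G w w′) e) (walk-reverse p)

module Reachability {C} (G : Graph C) (bad : V G → Bool) where
  open Walks G

  Outside : V G → Set
  Outside w = ¬ T (bad w)

  start : V G → V G → Bool
  start r w = does (w ≟ r) ∧ not (bad w)

  expand : (V G → Bool) → V G → Bool
  expand f w = f w ∨ (not (bad w) ∧ (0 <ᵇ count (λ t → E G t w ∧ f t)))

  expand-cong : ∀ {f g} → (∀ i → f i ≡ g i) → ∀ w → expand f w ≡ expand g w
  expand-cong f≗g w =
    cong₂ (λ a c → a ∨ (not (bad w) ∧ (0 <ᵇ c))) (f≗g w) (count-cong (λ t → cong (E G t w ∧_) (f≗g t)))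

  expand-infl : ∀ f w → T (f w) → T (expand f w)
  expand-infl f w = T-∨⁺ ∘ inj₁

  open Saturation expand expand-cong expand-infl

  reached : ℕ → V G → V G → Bool
  reached d r = iter d (start r)

  reached⇒walk : ∀ d r w → T (reached d r w) → Walk G Outside r w
  reached⇒walk zero r w x with w ≟ r | T-∧⁻ {does (w ≟ r)} x
  ... | yes refl | _ , out = here (T-not⁻ out)
  ... | no _     | () , _
  reached⇒walk (suc d) r w x with T-∨⁻ {reached d r w} x
  ... | inj₁ old = reached⇒walk d r w old
  ... | inj₂ new with T-∧⁻ new
  ...   | out , pos with count-pos⁻ (λ t → E G t w ∧ reached d r t) pos
  ...     | t , et with T-∧⁻ et
  ...       | e , xt = step (reached⇒walk d r t xt) (T-not⁻ out) e

  walk⇒reached : ∀ {r w} → Walk G Outside r w → ∃ λ d → T (reached d r w)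
  walk⇒reached {r} (here out) = 0 , T-∧⁺ (≟-self r) (T-not⁺ out)
  walk⇒reached {r} (step {w} {w′} p out e) with walk⇒reached p
  ... | d , x = suc d , T-∨⁺ (inj₂ (T-∧⁺ (T-not⁺ out)
                  (count-pos⁺ (λ t → E G t w′ ∧ reached d r t) w (T-∧⁺ e x))))

  walk⇒reached-at : ∀ n → N G ≤ n → ∀ {r w} → Walk G Outside r w → T (reached n r w)
  walk⇒reached-at n |G|≤n {r} {w} p = saturated (start r) n |G|≤n (proj₁ reach) w (proj₂ reach)
    where
    reach : ∃ λ d → T (reached d r w)
    reach = walk⇒reached p

  reached-component : ∀ n → N G ≤ n → ∀ v → IsComponent G Outside v (reached n v)
  reached-component n |G|≤n v w = reached⇒walk n v w , walk⇒reached-at n |G|≤n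

  component-reached : ∀ n → N G ≤ n → ∀ {v A} → IsComponent G Outside v A →
    ∀ {r} → T (A r) → ∀ w → A w ≡ reached n r w
  component-reached n |G|≤n {v} {A} isComp {r} Ar w = T-ext to from
    where
    v⇝r : Walk G Outside v r
    v⇝r = proj₁ (isComp r) Ar
    to : T (A w) → T (reached n r w)
    to Aw = walk⇒reached-at n |G|≤n (walk-append (walk-reverse v⇝r) (proj₁ (isComp w) Aw))
    from : T (reached n r w) → T (A w)
    from x = proj₂ (isComp w) (walk-append v⇝r (reached⇒walk n r w x))

module _ {C : ℕ} where

  and : Fm C → Fm C → Fm C
  and θ θ′ = neg (or (neg θ) (neg θ′))

  sat-and : ∀ (G : Graph C) ρ θ θ′ → sat G ρ (and θ θ′) ≡ (sat G ρ θ ∧ sat G ρ θ′)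
  sat-and G ρ θ θ′ with sat G ρ θ | sat G ρ θ′
  ... | true  | true  = refl
  ... | true  | false = refl
  ... | false | _     = refl

  free-and : ∀ {θ θ′ : Fm C} {z} → Free (and θ θ′) z → Free θ z ⊎ Free θ′ z
  free-and (neg′ (orˡ (neg′ fz))) = inj₁ fz
  free-and (neg′ (orʳ (neg′ fz))) = inj₂ fz

  sat-pin : ∀ (G : Graph C) ρ x y (θ : Fm C) → ¬ y ≡ x →
    sat G ρ (cnt 0 x (and (eq x y) θ)) ≡ sat G (update ρ x (ρ y)) θ
  sat-pin G ρ x y θ y≢x = begin
    0 <ᵇ count (λ w → sat G (update ρ x w) (and (eq x y) θ))
      ≡⟨ cong (0 <ᵇ_) (count-cong pointwise) ⟩
    0 <ᵇ count (λ w → does (w ≟ ρ y) ∧ sat G (update ρ x w) θ)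
      ≡⟨ cong (0 <ᵇ_) (count-single (ρ y) (λ w → sat G (update ρ x w) θ)) ⟩
    0 <ᵇ bit (sat G (update ρ x (ρ y)) θ)
      ≡⟨ 0<ᵇbit _ ⟩
    sat G (update ρ x (ρ y)) θ ∎
    where
    open ≡-Reasoning
    pointwise : ∀ w → sat G (update ρ x w) (and (eq x y) θ) ≡ (does (w ≟ ρ y) ∧ sat G (update ρ x w) θ)
    pointwise w rewrite sat-and G (update ρ x w) (eq x y) θ
                      | update-same ρ x w | update-other ρ x w y y≢x = refl

  FF TT : Fm C
  FF = cnt 0 0 (neg (eq 0 0))
  TT = neg FF

  sat-FF : ∀ (G : Graph C) ρ → sat G ρ FF ≡ false
  sat-FF G ρ = cong (0 <ᵇ_) (trans (count-cong never) (count-false (N G)))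
    where
    never : ∀ w → not (does (update ρ 0 w 0 ≟ update ρ 0 w 0)) ≡ false
    never w = cong not (dec-true (update ρ 0 w 0 ≟ update ρ 0 w 0) refl)

  fv : Fm C → List Var
  fv (eq x y)    = x ∷ y ∷ []
  fv (edge x y)  = x ∷ y ∷ []
  fv (col c x y) = x ∷ y ∷ []
  fv (neg θ)     = fv θ
  fv (or θ θ′)   = fv θ ++ fv θ′
  fv (cnt q x θ) = filter (λ z → ¬? (z ℕP.≟ x)) (fv θ)

  fv-sound : ∀ (θ : Fm C) z → Free θ z → z ∈ fv θ
  fv-sound (eq x y)    z eq₁   = here refl
  fv-sound (eq x y)    z eq₂   = there (here refl)
  fv-sound (edge x y)  z edge₁ = here refl
  fv-sound (edge x y)  z edge₂ = there (here refl)
  fv-sound (col c x y) z col₁  = here refl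
  fv-sound (col c x y) z col₂  = there (here refl)
  fv-sound (neg θ)     z (neg′ fz) = fv-sound θ z fz
  fv-sound (or θ θ′)   z (orˡ fz)  = ∈-++⁺ˡ (fv-sound θ z fz)
  fv-sound (or θ θ′)   z (orʳ fz)  = ∈-++⁺ʳ (fv θ) (fv-sound θ′ z fz)
  fv-sound (cnt q x θ) z (cnt′ fz z≢x) = ∈-filter⁺ (λ z → ¬? (z ℕP.≟ x)) (fv-sound θ z fz) z≢x

  fv-complete : ∀ (θ : Fm C) z → z ∈ fv θ → Free θ z
  fv-complete (eq x y)    z (here refl)         = eq₁
  fv-complete (eq x y)    z (there (here refl)) = eq₂
  fv-complete (edge x y)  z (here refl)         = edge₁
  fv-complete (edge x y)  z (there (here refl)) = edge₂
  fv-complete (col c x y) z (here refl)         = col₁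
  fv-complete (col c x y) z (there (here refl)) = col₂
  fv-complete (neg θ)     z z∈ = neg′ (fv-complete θ z z∈)
  fv-complete (or θ θ′)   z z∈ with ∈-++⁻ (fv θ) z∈
  ... | inj₁ z∈θ  = orˡ (fv-complete θ z z∈θ)
  ... | inj₂ z∈θ′ = orʳ (fv-complete θ′ z z∈θ′)
  fv-complete (cnt q x θ) z z∈ with ∈-filter⁻ (λ z → ¬? (z ℕP.≟ x)) z∈
  ... | z∈θ , z≢x = cnt′ (fv-complete θ z z∈θ) z≢x

  free? : ∀ (θ : Fm C) z → Dec (Free θ z)
  free? θ z = map′ (fv-complete θ z) (fv-sound θ z) (z ∈? fv θ)

  data Anchor (θ : Fm C) : Set where
    closed   : (∀ z → ¬ Free θ z) → Anchor θ
    anchored : ∀ r → Free θ r → Anchor θ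

  anchor : ∀ θ → Anchor θ
  anchor θ = from (fv θ) (fv-sound θ) (fv-complete θ)
    where
    from : ∀ L → (∀ z → Free θ z → z ∈ L) → (∀ z → z ∈ L → Free θ z) → Anchor θ
    from []      sound _        = closed (λ z fz → case sound z fz of λ ())
    from (r ∷ _) _     complete = anchored r (complete r (here refl))

  FreeIn : List Var → Fm C → Set
  FreeIn L θ = ∀ z → Free θ z → z ∈ L

  -- θ has width ≤ w and its free variables lie in L.  Combined with
  -- |L| ≤ w this is closed under the connectives, which is how all
  -- width bounds below are established.
  Fits : ℕ → List Var → Fm C → Set
  Fits w L θ = Width w θ × FreeIn L θ

  module _ {w : ℕ} {L : List Var} (|L|≤w : length L ≤ w) where

    fits-eq : ∀ {x y} → x ∈ L → y ∈ L → Fits w L (eq x y)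
    fits-eq {x} {y} x∈ y∈ = (L , |L|≤w , free) , free
      where
      free : FreeIn L (eq x y)
      free = λ { _ eq₁ → x∈ ; _ eq₂ → y∈ }

    fits-edge : ∀ {x y} → x ∈ L → y ∈ L → Fits w L (edge x y)
    fits-edge {x} {y} x∈ y∈ = (L , |L|≤w , free) , free
      where
      free : FreeIn L (edge x y)
      free = λ { _ edge₁ → x∈ ; _ edge₂ → y∈ }

    fits-neg : ∀ {θ} → Fits w L θ → Fits w L (neg θ)
    fits-neg {θ} (wd , free) = ((L , |L|≤w , free′) , wd) , free′
      where
      free′ : FreeIn L (neg θ)
      free′ = λ { z (neg′ fz) → free z fz }

    fits-or : ∀ {θ θ′} → Fits w L θ → Fits w L θ′ → Fits w L (or θ θ′)
    fits-or {θ} {θ′} (wd , free) (wd′ , free′) = ((L , |L|≤w , free″) , wd , wd′) , free″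
      where
      free″ : FreeIn L (or θ θ′)
      free″ = λ { z (orˡ fz) → free z fz ; z (orʳ fz) → free′ z fz }

    fits-and : ∀ {θ θ′} → Fits w L θ → Fits w L θ′ → Fits w L (and θ θ′)
    fits-and a b = fits-neg (fits-or (fits-neg a) (fits-neg b))

    fits-cnt : ∀ {q x θ} → Fits w (x ∷ L) θ → Fits w L (cnt q x θ)
    fits-cnt {x = x} (wd , free) = ((L , |L|≤w , free′) , wd) , free′
      where
      free′ : FreeIn L (cnt _ x _)
      free′ z (cnt′ fz z≢x) with free z fz
      ... | here z≡x = ⊥-elim (z≢x z≡x)
      ... | there z∈ = z∈

  fits-weaken : ∀ {w L L′} {θ : Fm C} → L ⊆ L′ → Fits w L θ → Fits w L′ θ
  fits-weaken L⊆L′ (wd , free) = wd , λ z → L⊆L′ ∘ free z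

  fits-FF : ∀ {w} → 1 ≤ w → Fits w [] FF
  fits-FF 1≤w = fits-cnt z≤n (fits-neg 1≤w (fits-eq 1≤w (here refl) (here refl)))

  width⇒freeBound : ∀ {w} (θ : Fm C) → Width w θ → FreeBound w θ
  width⇒freeBound (eq x y)    wd      = wd
  width⇒freeBound (edge x y)  wd      = wd
  width⇒freeBound (col c x y) wd      = wd
  width⇒freeBound (neg θ)     (fb , _) = fb
  width⇒freeBound (or θ θ′)   (fb , _) = fb
  width⇒freeBound (cnt q x θ) (fb , _) = fb

  fb-mono : ∀ {w w′} {θ : Fm C} → w ≤ w′ → FreeBound w θ → FreeBound w′ θ
  fb-mono w≤w′ (L , |L|≤w , free) = L , ℕP.≤-trans |L|≤w w≤w′ , free

  width-mono : ∀ {w w′} (θ : Fm C) → w ≤ w′ → Width w θ → Width w′ θ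
  width-mono (eq x y)    w≤w′ wd = fb-mono w≤w′ wd
  width-mono (edge x y)  w≤w′ wd = fb-mono w≤w′ wd
  width-mono (col c x y) w≤w′ wd = fb-mono w≤w′ wd
  width-mono (neg θ)     w≤w′ (fb , wd) = fb-mono w≤w′ fb , width-mono θ w≤w′ wd
  width-mono (or θ θ′)   w≤w′ (fb , wd , wd′) =
    fb-mono w≤w′ fb , width-mono θ w≤w′ wd , width-mono θ′ w≤w′ wd′
  width-mono (cnt q x θ) w≤w′ (fb , wd) = fb-mono w≤w′ fb , width-mono θ w≤w′ wd

-- Variable layout (also used by the translation below):
-- x_i is variable i for i < k, y is variable k, s = k+1 is scratch.
module Guards {C : ℕ} (k : ℕ) (φ : Fm C) where

  xs : List Var
  xs = upTo k

  s : Var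
  s = suc k

  notInU : Var → Fm C
  notInU a = neg (cnt 0 k (and (eq k a) φ))

  reach : ℕ → Var → Var → Fm C

  -- s is a neighbour of a joined to b by a walk of length ≤ d avoiding U;
  -- re-using a for s keeps the number of variables at three.
  viaNeighbour : ℕ → Var → Var → Fm C

  reach zero    a b = and (eq a b) (notInU a)
  reach (suc d) a b = or (reach d a b) (and (notInU a) (cnt 0 s (viaNeighbour d a b)))

  viaNeighbour d a b = and (edge s a) (cnt 0 a (and (eq a s) (reach d a b)))

  module GuardWidth (w : ℕ) (3+k≤w : 3 + k ≤ w) (wφ : Width w φ) (fφ : FreeAmong (suc k) φ) where

    room : ∀ j → j ≤ 3 → j + length xs ≤ w
    room j j≤3 rewrite ListP.length-upTo k = ℕP.≤-trans (ℕP.+-monoˡ-≤ k j≤3) 3+k≤w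

    room₁ : 1 + length xs ≤ w
    room₁ = room 1 (s≤s z≤n)

    room₂ : 2 + length xs ≤ w
    room₂ = room 2 (s≤s (s≤s z≤n))

    room₃ : 3 + length xs ≤ w
    room₃ = room 3 ℕP.≤-refl

    insert₂ : ∀ {a b} {L : List Var} → (a ∷ L) ⊆ (a ∷ b ∷ L)
    insert₂ {a} {b} {L} = ∷⁺ʳ a (xs⊆x∷xs L b)

    params : ∀ {z} → z < suc k → z ∈ (k ∷ xs)
    params z<1+k with ℕP.m<1+n⇒m<n∨m≡n z<1+k
    ... | inj₁ z<k  = there (∈-upTo⁺ z<k)
    ... | inj₂ refl = here refl

    fits-notInU : ∀ a → Fits w (a ∷ xs) (notInU a)
    fits-notInU a = fits-neg room₁ (fits-cnt room₁ (fits-and room₂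
      (fits-eq room₂ (here refl) (there (here refl)))
      (wφ , λ z → insert₂ ∘ params ∘ fφ z)))

    fits-reach : ∀ d a b → Fits w (a ∷ b ∷ xs) (reach d a b)
    fits-reach zero a b =
      fits-and room₂ (fits-eq room₂ (here refl) (there (here refl))) (fits-weaken insert₂ (fits-notInU a))
    fits-reach (suc d) a b =
      fits-or room₂ (fits-reach d a b)
        (fits-and room₂ (fits-weaken insert₂ (fits-notInU a))
          (fits-cnt room₂ (fits-and room₃ (fits-edge room₃ (here refl) (there (here refl)))
            (fits-weaken insert₂ (fits-cnt room₂ (fits-and room₃
              (fits-eq room₃ (here refl) (there (here refl)))
              (fits-weaken insert₂ (fits-reach d a b))))))))

  module GuardSemantics (fφ : FreeAmong (suc k) φ) (G : Graph C) (u : Fin k → V G) where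

    bad : V G → Bool
    bad w = sat G (env k u w) φ

    open Reachability G bad public

    Params : (Var → V G) → Set
    Params ρ = ∀ z (p : z < k) → ρ z ≡ u (fromℕ< p)

    params-update : ∀ ρ x a → k ≤ x → Params ρ → Params (update ρ x a)
    params-update ρ x a k≤x pρ z z<k =
      trans (update-other ρ x a z (λ z≡x → ℕP.<-irrefl z≡x (ℕP.<-≤-trans z<k k≤x))) (pρ z z<k)

    env-param : ∀ v z (p : z < k) → env k u v z ≡ u (fromℕ< p)
    env-param v z p with z <? k
    ... | yes _  = refl
    ... | no z≮k = ⊥-elim (z≮k p)

    env-y : ∀ v → env k u v k ≡ v
    env-y v with k <? k
    ... | yes k<k = ⊥-elim (ℕP.<-irrefl refl k<k)
    ... | no _    = refl

    -- φ only looks at x̄ and y.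
    sat-φ : ∀ ρ → Params ρ → sat G ρ φ ≡ bad (ρ k)
    sat-φ ρ pρ = sat-coinc G φ ρ (env k u (ρ k)) agree
      where
      agree : ∀ z → Free φ z → ρ z ≡ env k u (ρ k) z
      agree z fz with ℕP.m<1+n⇒m<n∨m≡n (fφ z fz)
      ... | inj₁ z<k  = trans (pρ z z<k) (sym (env-param (ρ k) z z<k))
      ... | inj₂ refl = sym (env-y (ρ z))

    sat-notInU : ∀ ρ a → Params ρ → k < a → sat G ρ (notInU a) ≡ not (bad (ρ a))
    sat-notInU ρ a pρ k<a = cong not (begin
      sat G ρ (cnt 0 k (and (eq k a) φ))     ≡⟨ sat-pin G ρ k a φ (λ a≡k → ℕP.<-irrefl (sym a≡k) k<a) ⟩
      sat G (update ρ k (ρ a)) φ             ≡⟨ sat-φ _ (params-update ρ k (ρ a) ℕP.≤-refl pρ) ⟩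
      bad (update ρ k (ρ a) k)               ≡⟨ cong bad (update-same ρ k (ρ a)) ⟩
      bad (ρ a)                              ∎)
      where open ≡-Reasoning

    sat-viaNeighbour : ∀ d a b → s < a → ¬ b ≡ a → ¬ b ≡ s →
      (∀ ρ′ → Params ρ′ → sat G ρ′ (reach d a b) ≡ reached d (ρ′ b) (ρ′ a)) →
      ∀ ρ → Params ρ → ∀ t →
      sat G (update ρ s t) (viaNeighbour d a b) ≡ (E G t (ρ a) ∧ reached d (ρ b) t)
    sat-viaNeighbour d a b s<a b≢a b≢s sat-reach-d ρ pρ t = begin
      sat G ρ₁ (viaNeighbour d a b)
        ≡⟨ sat-and G ρ₁ (edge s a) (cnt 0 a (and (eq a s) (reach d a b))) ⟩
      E G (ρ₁ s) (ρ₁ a) ∧ sat G ρ₁ (cnt 0 a (and (eq a s) (reach d a b)))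
        ≡⟨ cong₂ _∧_ (cong₂ (E G) (update-same ρ s t) (update-other ρ s t a a≢s))
                     (sat-pin G ρ₁ a s (reach d a b) (a≢s ∘ sym)) ⟩
      E G t (ρ a) ∧ sat G ρ₂ (reach d a b)
        ≡⟨ cong (E G t (ρ a) ∧_) (sat-reach-d ρ₂ pρ₂) ⟩
      E G t (ρ a) ∧ reached d (ρ₂ b) (ρ₂ a)
        ≡⟨ cong₂ (λ r w → E G t (ρ a) ∧ reached d r w) ρ₂b ρ₂a ⟩
      E G t (ρ a) ∧ reached d (ρ b) t ∎
      where
      open ≡-Reasoning
      a≢s : ¬ a ≡ s
      a≢s a≡s = ℕP.<-irrefl (sym a≡s) s<a
      ρ₁ ρ₂ : Var → V G
      ρ₁ = update ρ s t
      ρ₂ = update ρ₁ a (ρ₁ s)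
      pρ₂ : Params ρ₂
      pρ₂ = params-update ρ₁ a _ (ℕP.<⇒≤ (ℕP.<-trans (ℕP.n<1+n k) s<a)) (params-update ρ s t (ℕP.n≤1+n k) pρ)
      ρ₂b : ρ₂ b ≡ ρ b
      ρ₂b = trans (update-other ρ₁ a _ b b≢a) (update-other ρ s t b b≢s)
      ρ₂a : ρ₂ a ≡ t
      ρ₂a = trans (update-same ρ₁ a (ρ₁ s)) (update-same ρ s t)

    sat-reach : ∀ d ρ a b → Params ρ → s < a → ¬ b ≡ a → ¬ b ≡ s →
      sat G ρ (reach d a b) ≡ reached d (ρ b) (ρ a)
    sat-reach zero ρ a b pρ s<a b≢a b≢s
      rewrite sat-and G ρ (eq a b) (notInU a) | sat-notInU ρ a pρ (ℕP.<-trans (ℕP.n<1+n k) s<a) = refl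
    sat-reach (suc d) ρ a b pρ s<a b≢a b≢s = cong₂ _∨_ (sat-reach d ρ a b pρ s<a b≢a b≢s) (begin
      sat G ρ (and (notInU a) (cnt 0 s (viaNeighbour d a b)))
        ≡⟨ sat-and G ρ (notInU a) (cnt 0 s (viaNeighbour d a b)) ⟩
      sat G ρ (notInU a) ∧ (0 <ᵇ count (λ t → sat G (update ρ s t) (viaNeighbour d a b)))
        ≡⟨ cong₂ (λ x c → x ∧ (0 <ᵇ c)) (sat-notInU ρ a pρ (ℕP.<-trans (ℕP.n<1+n k) s<a))
                 (count-cong (sat-viaNeighbour d a b s<a b≢a b≢s
                               (λ ρ′ pρ′ → sat-reach d ρ′ a b pρ′ s<a b≢a b≢s) ρ pρ)) ⟩
      not (bad (ρ a)) ∧ (0 <ᵇ count (λ t → E G t (ρ a) ∧ reached d (ρ b) t)) ∎)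
      where open ≡-Reasoning

-- The
-- translation produces trees so that tests about x̄, y (which would cost an
-- extra variable inside a formula of width k+ℓ) are hoisted to the top.
module _ {C : ℕ} where

  data Tree : Set where
    leaf : Fm C → Tree
    node : Fm C → Tree → Tree → Tree

  mapL : (Fm C → Fm C) → Tree → Tree
  mapL h (leaf f)     = leaf (h f)
  mapL h (node c t e) = node c (mapL h t) (mapL h e)

  graft : Tree → Tree → Tree
  graft (leaf f)     T′ = mapL (or f) T′
  graft (node c t e) T′ = node c (graft t T′) (graft e T′)

  toFm : Tree → Fm C
  toFm (leaf f)     = f
  toFm (node c t e) = or (and c (toFm t)) (and (neg c) (toFm e))

  sel : (G : Graph C) → (Var → V G) → Tree → Fm C
  sel G ρ (leaf f)     = f
  sel G ρ (node c t e) = if sat G ρ c then sel G ρ t else sel G ρ e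

  AllC : (Fm C → Set) → Tree → Set
  AllC P (leaf f)     = ⊤
  AllC P (node c t e) = P c × AllC P t × AllC P e

  AllL : (Fm C → Set) → Tree → Set
  AllL P (leaf f)     = P f
  AllL P (node c t e) = AllL P t × AllL P e

  sel-mapL : ∀ G ρ h T → sel G ρ (mapL h T) ≡ h (sel G ρ T)
  sel-mapL G ρ h (leaf f) = refl
  sel-mapL G ρ h (node c t e) with sat G ρ c
  ... | true  = sel-mapL G ρ h t
  ... | false = sel-mapL G ρ h e

  sel-graft : ∀ G ρ T T′ → sel G ρ (graft T T′) ≡ or (sel G ρ T) (sel G ρ T′)
  sel-graft G ρ (leaf f) T′ = sel-mapL G ρ (or f) T′
  sel-graft G ρ (node c t e) T′ with sat G ρ c
  ... | true  = sel-graft G ρ t T′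
  ... | false = sel-graft G ρ e T′

  sat-toFm : ∀ G ρ T → sat G ρ (toFm T) ≡ sat G ρ (sel G ρ T)
  sat-toFm G ρ (leaf f) = refl
  sat-toFm G ρ (node c t e)
    rewrite sat-and G ρ c (toFm t) | sat-and G ρ (neg c) (toFm e) with sat G ρ c
  ... | true  = trans (BoolP.∨-identityʳ _) (sat-toFm G ρ t)
  ... | false = sat-toFm G ρ e

  sel-coinc : ∀ L G ρ ρ′ T → AllC (FreeIn L) T → (∀ z → z ∈ L → ρ z ≡ ρ′ z) →
    sel G ρ T ≡ sel G ρ′ T
  sel-coinc L G ρ ρ′ (leaf f) _ agree = refl
  sel-coinc L G ρ ρ′ (node c t e) (fc , ft , fe) agree
    rewrite sat-coinc G c ρ ρ′ (λ z → agree z ∘ fc z) with sat G ρ′ c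
  ... | true  = sel-coinc L G ρ ρ′ t ft agree
  ... | false = sel-coinc L G ρ ρ′ e fe agree

  allC-weaken : ∀ {P Q} T → (∀ {f} → P f → Q f) → AllC P T → AllC Q T
  allC-weaken (leaf f)     P⇒Q _ = tt
  allC-weaken (node c t e) P⇒Q (pc , pt , pe) = P⇒Q pc , allC-weaken t P⇒Q pt , allC-weaken e P⇒Q pe

  allL-weaken : ∀ {P Q} T → (∀ {f} → P f → Q f) → AllL P T → AllL Q T
  allL-weaken (leaf f)     P⇒Q pf       = P⇒Q pf
  allL-weaken (node c t e) P⇒Q (pt , pe) = allL-weaken t P⇒Q pt , allL-weaken e P⇒Q pe

  allC-mapL : ∀ {P} h T → AllC P T → AllC P (mapL h T)
  allC-mapL h (leaf f)     _ = tt
  allC-mapL h (node c t e) (pc , pt , pe) = pc , allC-mapL h t pt , allC-mapL h e pe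

  allL-mapL : ∀ {P Q} h T → (∀ {f} → P f → Q (h f)) → AllL P T → AllL Q (mapL h T)
  allL-mapL h (leaf f)     P⇒Qh pf = P⇒Qh pf
  allL-mapL h (node c t e) P⇒Qh (pt , pe) = allL-mapL h t P⇒Qh pt , allL-mapL h e P⇒Qh pe

  allC-graft : ∀ {P} T T′ → AllC P T → AllC P T′ → AllC P (graft T T′)
  allC-graft (leaf f)     T′ _ p′ = allC-mapL (or f) T′ p′
  allC-graft (node c t e) T′ (pc , pt , pe) p′ = pc , allC-graft t T′ pt p′ , allC-graft e T′ pe p′

  allL-graft : ∀ {P Q R} T T′ → (∀ {f g} → P f → Q g → R (or f g)) →
    AllL P T → AllL Q T′ → AllL R (graft T T′)
  allL-graft (leaf f) T′ PQ⇒R pf q = allL-mapL (or f) T′ (PQ⇒R pf) q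
  allL-graft (node c t e) T′ PQ⇒R (pt , pe) q = allL-graft t T′ PQ⇒R pt q , allL-graft e T′ PQ⇒R pe q

  fits-toFm : ∀ {w L} → length L ≤ w → ∀ T → AllC (Fits w L) T → AllL (Fits w L) T → Fits w L (toFm T)
  fits-toFm |L|≤w (leaf f) _ fl = fl
  fits-toFm |L|≤w (node c t e) (fc , ct , ce) (lt , le) =
    fits-or |L|≤w (fits-and |L|≤w fc (fits-toFm |L|≤w t ct lt))
                  (fits-and |L|≤w (fits-neg |L|≤w fc) (fits-toFm |L|≤w e ce le))

-- A counting quantifier ∃^{≥p} z θ
-- is restricted to the component of an anchor: a free variable r of the
-- quantified formula (its value lies in A), or y itself if the formula is
-- closed.  Mentioning y costs an extra variable, so a closed subformula is
-- translated into a test of the decision tree instead of a leaf.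
module Relativisation {C : ℕ} (k n : ℕ) (φ : Fm C) where
  open Guards k φ public

  tr : Var → Var
  tr z = suc (suc (k + z))

  -- a lies in the component of b; n ≥ |G| search rounds suffice.
  guard : Var → Var → Fm C
  guard a b = reach n a b

  -- ∃^{≥p} z θ relativised with anchor y, anchor r, and, when z is not
  -- free in θ, as "A has ≥ p vertices, and θ".
  relY : ℕ → Var → Fm C → Fm C
  relY q z f = cnt q (tr z) (and (guard (tr z) k) f)

  relIn : ℕ → Var → Var → Fm C → Fm C
  relIn q z r f = cnt q (tr z) (and (guard (tr z) (tr r)) f)

  relOut : ℕ → Var → Var → Fm C → Fm C
  relOut q z r f = and (cnt q (tr z) (guard (tr z) (tr r))) f

  trCnt : ∀ q z (θ : Fm C) → Tree {C} → Anchor (cnt q z θ) → Dec (Free θ z) → Tree {C}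
  trCnt q z θ T (closed _)     _       = node (toFm (mapL (relY q z) T)) (leaf TT) (leaf FF)
  trCnt q z θ T (anchored r _) (yes _) = mapL (relIn q z r) T
  trCnt q z θ T (anchored r _) (no _)  = mapL (relOut q z r) T

  Tr : Fm C → Tree {C}
  Tr (eq x y)    = leaf (eq (tr x) (tr y))
  Tr (edge x y)  = leaf (edge (tr x) (tr y))
  Tr (col c x y) = leaf (col c (tr x) (tr y))
  Tr (neg θ)     = mapL neg (Tr θ)
  Tr (or θ θ′)   = graft (Tr θ) (Tr θ′)
  Tr (cnt q z θ) = trCnt q z θ (Tr θ) (anchor (cnt q z θ)) (free? θ z)

  data InScope (χ : Fm C) : Var → Set where
    param : ∀ {x} → x < k → InScope χ x
    image : ∀ {z} → Free χ z → InScope χ (tr z)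

  Scoped : Fm C → Fm C → Set
  Scoped χ f = ∀ x → Free f x → InScope χ x

  scope-widen : ∀ {χ χ′ x} → (∀ {z} → Free χ z → Free χ′ z) → InScope χ x → InScope χ′ x
  scope-widen χ⊆χ′ (param x<k) = param x<k
  scope-widen χ⊆χ′ (image fz)  = image (χ⊆χ′ fz)

  tr-injective : ∀ {x y} → tr x ≡ tr y → x ≡ y
  tr-injective e = ℕP.+-cancelˡ-≡ k _ _ (ℕP.suc-injective (ℕP.suc-injective e))

  s<tr : ∀ z → s < tr z
  s<tr z = s≤s (s≤s (ℕP.m≤m+n k z))

  body-scope : ∀ {q z θ x} → InScope θ x → ¬ (x ≡ tr z × Free θ z) → InScope (cnt q z θ) x
  body-scope         (param x<k) _ = param x<k
  body-scope {z = z} (image {z₀} fz₀) not-z with z₀ ℕP.≟ z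
  ... | yes refl = ⊥-elim (not-z (refl , fz₀))
  ... | no z₀≢z  = image (cnt′ fz₀ z₀≢z)

  module WellFormed (ℓ w : ℕ) (3≤ℓ : 3 ≤ ℓ) (k+ℓ≤w : k + ℓ ≤ w)
                    (wφ : Width w φ) (fφ : FreeAmong (suc k) φ) where

    3+k≤w : 3 + k ≤ w
    3+k≤w = ℕP.≤-trans (ℕP.≤-reflexive (ℕP.+-comm 3 k)) (ℕP.≤-trans (ℕP.+-monoʳ-≤ k 3≤ℓ) k+ℓ≤w)

    open GuardWidth w 3+k≤w wφ fφ public

    Lk : List Var
    Lk = k ∷ xs

    Lk-params : ∀ {z} → z ∈ Lk → z < suc k
    Lk-params (here refl) = ℕP.≤-refl
    Lk-params (there z∈)  = ℕP.m≤n⇒m≤1+n (∈-upTo⁻ z∈)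

    Cond : Fm C → Set
    Cond = Fits w Lk

    Leaf : Fm C → Fm C → Set
    Leaf χ f = Width w f × Scoped χ f

    WF : Fm C → Tree {C} → Set
    WF χ T = AllC Cond T × AllL (Leaf χ) T

    room-tr : ∀ (L : List Var) → length L ≤ ℓ → length (map tr L ++ xs) ≤ w
    room-tr L |L|≤ℓ rewrite ListP.length-++ (map tr L) {xs} | ListP.length-map tr L | ListP.length-upTo k =
      ℕP.≤-trans (ℕP.+-monoˡ-≤ k |L|≤ℓ) (ℕP.≤-trans (ℕP.≤-reflexive (ℕP.+-comm ℓ k)) k+ℓ≤w)

    scoped⇒freeIn : ∀ {χ f L} → FreeIn L χ → Scoped χ f → FreeIn (map tr L ++ xs) f
    scoped⇒freeIn cover scoped x fx with scoped x fx
    ... | param x<k   = ∈-++⁺ʳ _ (∈-upTo⁺ x<k)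
    ... | image {z} fz = ∈-++⁺ˡ (∈-map⁺ tr (cover z fz))

    scoped-bound : ∀ {χ f} → FreeBound ℓ χ → Scoped χ f → FreeBound w f
    scoped-bound (L , |L|≤ℓ , cover) scoped = map tr L ++ xs , room-tr L |L|≤ℓ , scoped⇒freeIn cover scoped

    guard-scope : ∀ {q z θ r x} → Free (cnt q z θ) r → Free (guard (tr z) (tr r)) x → ¬ x ≡ tr z →
      InScope (cnt q z θ) x
    guard-scope fr fx x≢trz with proj₂ (fits-reach n _ _) _ fx
    ... | here x≡trz         = ⊥-elim (x≢trz x≡trz)
    ... | there (here refl)  = image fr
    ... | there (there x∈xs) = param (∈-upTo⁻ x∈xs)

    wf-closed : ∀ q z θ T → (∀ x → ¬ Free (cnt q z θ) x) → WF θ T →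
      WF (cnt q z θ) (node (toFm (mapL (relY q z) T)) (leaf TT) (leaf FF))
    wf-closed q z θ T isClosed (conds , leaves) =
      (fits-toFm room₁ _ (allC-mapL _ T conds) (allL-mapL _ T test leaves) , tt , tt) ,
      constant (fits-neg z≤n ff) , constant ff
      where
      ff : Fits w [] FF
      ff = fits-FF (ℕP.≤-trans (s≤s z≤n) 3+k≤w)
      constant : ∀ {f} → Fits w [] f → Leaf (cnt q z θ) f
      constant (wd , free) = wd , λ x fx → case free x fx of λ ()
      test : ∀ {f} → Leaf θ f → Cond (relY q z f)
      test {f} (wd , scoped) = fits-cnt room₁ (fits-and room₂ (fits-reach n (tr z) k) (wd , free))
        where
        free : FreeIn (tr z ∷ Lk) f
        free x fx with scoped x fx
        ... | param x<k = there (there (∈-upTo⁺ x<k))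
        ... | image {z₀} fz₀ with z₀ ℕP.≟ z
        ...   | yes refl = here refl
        ...   | no z₀≢z  = ⊥-elim (isClosed z₀ (cnt′ fz₀ z₀≢z))

    wf-in : ∀ q z θ r T → Free (cnt q z θ) r → Free θ z → FreeBound ℓ (cnt q z θ) → FreeBound ℓ θ →
      WF θ T → WF (cnt q z θ) (mapL (relIn q z r) T)
    wf-in q z θ r T fr@(cnt′ frθ _) fz fbχ (Lθ , |Lθ|≤ℓ , coverθ) (conds , leaves) =
      allC-mapL _ T conds , allL-mapL _ T leafIn leaves
      where
      guardVars : (tr z ∷ tr r ∷ xs) ⊆ (map tr Lθ ++ xs)
      guardVars (here refl)         = ∈-++⁺ˡ (∈-map⁺ tr (coverθ z fz))
      guardVars (there (here refl)) = ∈-++⁺ˡ (∈-map⁺ tr (coverθ r frθ))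
      guardVars (there (there x∈))  = ∈-++⁺ʳ _ x∈
      leafIn : ∀ {f} → Leaf θ f → Leaf (cnt q z θ) (relIn q z r f)
      leafIn {f} (wd , scoped) = (scoped-bound fbχ scoped′ , proj₁ body) , scoped′
        where
        body : Fits w (map tr Lθ ++ xs) (and (guard (tr z) (tr r)) f)
        body = fits-and (room-tr Lθ |Lθ|≤ℓ) (fits-weaken guardVars (fits-reach n (tr z) (tr r)))
                        (wd , scoped⇒freeIn coverθ scoped)
        scoped′ : Scoped (cnt q z θ) (relIn q z r f)
        scoped′ x (cnt′ fx x≢trz) with free-and fx
        ... | inj₁ gx = guard-scope fr gx x≢trz
        ... | inj₂ fx′ = body-scope (scoped x fx′) (x≢trz ∘ proj₁)

    wf-out : ∀ q z θ r T → Free (cnt q z θ) r → ¬ Free θ z → FreeBound ℓ (cnt q z θ) →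
      WF θ T → WF (cnt q z θ) (mapL (relOut q z r) T)
    wf-out q z θ r T fr z∉θ (Lχ , |Lχ|≤ℓ , coverχ) (conds , leaves) =
      allC-mapL _ T conds , allL-mapL _ T leafOut leaves
      where
      guardVars : (tr r ∷ xs) ⊆ (map tr Lχ ++ xs)
      guardVars (here refl) = ∈-++⁺ˡ (∈-map⁺ tr (coverχ r fr))
      guardVars (there x∈)  = ∈-++⁺ʳ _ x∈
      leafOut : ∀ {f} → Leaf θ f → Leaf (cnt q z θ) (relOut q z r f)
      leafOut {f} (wd , scoped) = proj₁ whole , scoped′
        where
        body : Scoped (cnt q z θ) f
        body x fx = body-scope (scoped x fx) (z∉θ ∘ proj₂)
        whole : Fits w (map tr Lχ ++ xs) (relOut q z r f)
        whole = fits-and (room-tr Lχ |Lχ|≤ℓ) (fits-weaken guardVars (fits-cnt room₁ (fits-reach n (tr z) (tr r))))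
                         (wd , scoped⇒freeIn coverχ body)
        scoped′ : Scoped (cnt q z θ) (relOut q z r f)
        scoped′ x fx with free-and fx
        ... | inj₁ (cnt′ gx x≢trz) = guard-scope fr gx x≢trz
        ... | inj₂ fx′             = body x fx′

    wf-cnt : ∀ q z θ T (a : Anchor (cnt q z θ)) (d : Dec (Free θ z)) →
      FreeBound ℓ (cnt q z θ) → FreeBound ℓ θ → WF θ T → WF (cnt q z θ) (trCnt q z θ T a d)
    wf-cnt q z θ T (closed cl)     _        _   _   = wf-closed q z θ T cl
    wf-cnt q z θ T (anchored r fr) (yes fz) fbχ fbθ = wf-in q z θ r T fr fz fbχ fbθ
    wf-cnt q z θ T (anchored r fr) (no z∉θ) fbχ _   = wf-out q z θ r T fr z∉θ fbχ

    wf : ∀ χ → Width ℓ χ → WF χ (Tr χ)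
    wf (eq x y) wd = tt , scoped-bound wd scoped , scoped
      where
      scoped : Scoped (eq x y) (eq (tr x) (tr y))
      scoped = λ { _ eq₁ → image eq₁ ; _ eq₂ → image eq₂ }
    wf (edge x y) wd = tt , scoped-bound wd scoped , scoped
      where
      scoped : Scoped (edge x y) (edge (tr x) (tr y))
      scoped = λ { _ edge₁ → image edge₁ ; _ edge₂ → image edge₂ }
    wf (col c x y) wd = tt , scoped-bound wd scoped , scoped
      where
      scoped : Scoped (col c x y) (col c (tr x) (tr y))
      scoped = λ { _ col₁ → image col₁ ; _ col₂ → image col₂ }
    wf (neg χ) (fb , wd) = allC-mapL neg (Tr χ) (proj₁ (wf χ wd)) , allL-mapL neg (Tr χ) leafNeg (proj₂ (wf χ wd))
      where
      leafNeg : ∀ {f} → Leaf χ f → Leaf (neg χ) (neg f)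
      leafNeg {f} (wdf , scoped) = (scoped-bound fb scoped′ , wdf) , scoped′
        where
        scoped′ : Scoped (neg χ) (neg f)
        scoped′ = λ { x (neg′ fx) → scope-widen neg′ (scoped x fx) }
    wf (or χ χ′) (fb , wd , wd′) =
      allC-graft (Tr χ) (Tr χ′) (proj₁ (wf χ wd)) (proj₁ (wf χ′ wd′)) ,
      allL-graft (Tr χ) (Tr χ′) leafOr (proj₂ (wf χ wd)) (proj₂ (wf χ′ wd′))
      where
      leafOr : ∀ {f g} → Leaf χ f → Leaf χ′ g → Leaf (or χ χ′) (or f g)
      leafOr {f} {g} (wdf , sf) (wdg , sg) = (scoped-bound fb scoped′ , wdf , wdg) , scoped′
        where
        scoped′ : Scoped (or χ χ′) (or f g)
        scoped′ = λ { x (orˡ fx) → scope-widen orˡ (sf x fx) ; x (orʳ fx) → scope-widen orʳ (sg x fx) }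
    wf (cnt q z θ) (fb , wd) =
      wf-cnt q z θ (Tr θ) (anchor (cnt q z θ)) (free? θ z) fb (width⇒freeBound θ wd) (wf θ wd)

  module Correctness (ℓ w : ℕ) (3≤ℓ : 3 ≤ ℓ) (k+ℓ≤w : k + ℓ ≤ w)
                     (wφ : Width w φ) (fφ : FreeAmong (suc k) φ)
                     (G : Graph C) (|G|≤n : N G ≤ n) (u : Fin k → V G) (v : V G) (A : V G → Bool)
                     (v∉U : ¬ Holds G k φ u v) (isComp : IsComponent G (λ t → ¬ Holds G k φ u t) v A) where
    open WellFormed ℓ w 3≤ℓ k+ℓ≤w wφ fφ
    open GuardSemantics fφ G u

    H : Graph C
    H = induced G A

    v∈A : T (A v)
    v∈A = proj₂ (isComp v) (here v∉U)

    Standard : (Var → V G) → Set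
    Standard ρ = ∀ z → z < suc k → ρ z ≡ env k u v z

    standard-params : ∀ {ρ} → Standard ρ → Params ρ
    standard-params st z z<k = trans (st z (ℕP.m≤n⇒m≤1+n z<k)) (env-param v z z<k)

    standard-y : ∀ {ρ} → Standard ρ → ρ k ≡ v
    standard-y st = trans (st k ℕP.≤-refl) (env-y v)

    standard-agree : ∀ {ρ ρ′} → Standard ρ → Standard ρ′ → ∀ z → z ∈ Lk → ρ z ≡ ρ′ z
    standard-agree st st′ z z∈ = trans (st z (Lk-params z∈)) (sym (st′ z (Lk-params z∈)))

    param≢tr : ∀ {x} z → x < suc k → ¬ x ≡ tr z
    param≢tr z x<1+k refl = ℕP.<⇒≱ x<1+k (ℕP.<⇒≤ (s<tr z))

    standard-update : ∀ {ρ} z t → Standard ρ → Standard (update ρ (tr z) t)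
    standard-update {ρ} z t st x x<1+k = trans (update-other ρ (tr z) t x (param≢tr z x<1+k)) (st x x<1+k)

    Matches : Fm C → (Var → V G) → (Var → V H) → Set
    Matches χ ρ ρA = Standard ρ × (∀ z → Free χ z → ρ (tr z) ≡ emb A (ρA z))

    Correct : Fm C → Tree {C} → Set
    Correct χ T = ∀ ρ ρA → Matches χ ρ ρA → sat G ρ (sel G ρ T) ≡ sat H ρA χ

    matches-bind : ∀ {q z θ ρ ρA} → Matches (cnt q z θ) ρ ρA → ∀ i →
      Matches θ (update ρ (tr z) (emb A i)) (update ρA z i)
    matches-bind {z = z} {θ} {ρ} {ρA} (st , match) i = standard-update z (emb A i) st , match′
      where
      match′ : ∀ z₀ → Free θ z₀ → update ρ (tr z) (emb A i) (tr z₀) ≡ emb A (update ρA z i z₀)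
      match′ z₀ fz₀ with z₀ ℕP.≟ z
      ... | yes refl = trans (update-same ρ (tr z₀) (emb A i)) (cong (emb A) (sym (update-same ρA z₀ i)))
      ... | no z₀≢z  = trans (update-other ρ (tr z) (emb A i) (tr z₀) (z₀≢z ∘ tr-injective))
                             (trans (match z₀ (cnt′ fz₀ z₀≢z)) (cong (emb A) (sym (update-other ρA z i z₀ z₀≢z))))

    matches-vacuous : ∀ {q z θ ρ ρA} → ¬ Free θ z → Matches (cnt q z θ) ρ ρA → Matches θ ρ ρA
    matches-vacuous {z = z} z∉θ (st , match) =
      st , λ z₀ fz₀ → match z₀ (cnt′ fz₀ (λ z₀≡z → z∉θ (subst (Free _) z₀≡z fz₀)))

    anchor-in-A : ∀ {q z θ ρ ρA r} → Matches (cnt q z θ) ρ ρA → Free (cnt q z θ) r → T (A (ρ (tr r)))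
    anchor-in-A {ρA = ρA} {r} (_ , match) fr = subst (T ∘ A) (sym (match r fr)) (emb-in A (ρA r))

    sat-guard : ∀ ρ z b → Standard ρ → T (A (ρ b)) → ¬ b ≡ tr z → ¬ b ≡ s → ∀ t →
      sat G (update ρ (tr z) t) (guard (tr z) b) ≡ A t
    sat-guard ρ z b st Ab b≢trz b≢s t = begin
      sat G ρ′ (reach n (tr z) b)       ≡⟨ sat-reach n ρ′ (tr z) b params′ (s<tr z) b≢trz b≢s ⟩
      reached n (ρ′ b) (ρ′ (tr z))      ≡⟨ cong₂ (reached n) (update-other ρ (tr z) t b b≢trz) (update-same ρ (tr z) t) ⟩
      reached n (ρ b) t                 ≡⟨ sym (component-reached n |G|≤n isComp Ab t) ⟩
      A t                               ∎
      where
      open ≡-Reasoning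
      ρ′ : Var → V G
      ρ′ = update ρ (tr z) t
      params′ : Params ρ′
      params′ = params-update ρ (tr z) t (ℕP.<⇒≤ (ℕP.<-trans (ℕP.n<1+n k) (s<tr z))) (standard-params st)

    sat-anchored : ∀ q z θ Tθ b ρ ρA → AllC (FreeIn Lk) Tθ → Correct θ Tθ → Matches (cnt q z θ) ρ ρA →
      T (A (ρ b)) → ¬ b ≡ tr z → ¬ b ≡ s →
      sat G ρ (cnt q (tr z) (and (guard (tr z) b) (sel G ρ Tθ))) ≡ sat H ρA (cnt q z θ)
    sat-anchored q z θ Tθ b ρ ρA tests correctθ m@(st , _) Ab b≢trz b≢s = cong (suc q ≤ᵇ_) (begin
      count (λ t → sat G (ρ[ t ]) (and (guard (tr z) b) (sel G ρ Tθ)))   ≡⟨ count-cong guarded ⟩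
      count (λ t → A t ∧ body t)                                        ≡⟨ sym (count-emb A body) ⟩
      count (λ i → body (emb A i))                                      ≡⟨ count-cong inH ⟩
      count (λ i → sat H (update ρA z i) θ)                             ∎)
      where
      open ≡-Reasoning
      ρ[_] : V G → Var → V G
      ρ[ t ] = update ρ (tr z) t
      body : V G → Bool
      body t = sat G ρ[ t ] (sel G ρ[ t ] Tθ)
      guarded : ∀ t → sat G ρ[ t ] (and (guard (tr z) b) (sel G ρ Tθ)) ≡ (A t ∧ body t)
      guarded t = trans (sat-and G ρ[ t ] (guard (tr z) b) (sel G ρ Tθ))
        (cong₂ _∧_ (sat-guard ρ z b st Ab b≢trz b≢s t)
                   (cong (sat G ρ[ t ]) (sel-coinc Lk G ρ ρ[ t ] Tθ tests
                     (standard-agree st (standard-update z t st)))))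
      inH : ∀ i → body (emb A i) ≡ sat H (update ρA z i) θ
      inH i = correctθ ρ[ emb A i ] (update ρA z i) (matches-bind m i)

    sat-vacuous : ∀ q z θ Tθ r ρ ρA → Correct θ Tθ → Matches (cnt q z θ) ρ ρA →
      Free (cnt q z θ) r → ¬ Free θ z →
      sat G ρ (relOut q z r (sel G ρ Tθ)) ≡ sat H ρA (cnt q z θ)
    sat-vacuous q z θ Tθ r ρ ρA correctθ m@(st , _) fr@(cnt′ _ r≢z) z∉θ = begin
      sat G ρ (relOut q z r (sel G ρ Tθ))
        ≡⟨ sat-and G ρ (cnt q (tr z) (guard (tr z) (tr r))) (sel G ρ Tθ) ⟩
      (suc q ≤ᵇ count (λ t → sat G (update ρ (tr z) t) (guard (tr z) (tr r)))) ∧ sat G ρ (sel G ρ Tθ)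
        ≡⟨ cong₂ (λ c b → (suc q ≤ᵇ c) ∧ b)
             (count-cong (sat-guard ρ z (tr r) st (anchor-in-A m fr) (r≢z ∘ tr-injective) (ℕP.<⇒≢ (s<tr r) ∘ sym)))
             (correctθ ρ ρA (matches-vacuous z∉θ m)) ⟩
      (suc q ≤ᵇ count A) ∧ sat H ρA θ
        ≡⟨ threshold-const q A (sat H ρA θ) ⟩
      suc q ≤ᵇ count {size A} (λ _ → sat H ρA θ)
        ≡⟨ cong (suc q ≤ᵇ_) (count-cong λ i → sat-coinc H θ ρA (update ρA z i) λ z₀ fz₀ →
             sym (update-other ρA z i z₀ (λ z₀≡z → z∉θ (subst (Free θ) z₀≡z fz₀)))) ⟩
      sat H ρA (cnt q z θ) ∎
      where open ≡-Reasoning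

    sat-flag : ∀ ρ c → sat G ρ (sel G ρ (node c (leaf TT) (leaf FF))) ≡ sat G ρ c
    sat-flag ρ c with sat G ρ c
    ... | true  = cong not (sat-FF G ρ)
    ... | false = sat-FF G ρ

    correct-cnt : ∀ q z θ Tθ (a : Anchor (cnt q z θ)) (d : Dec (Free θ z)) →
      AllC (FreeIn Lk) Tθ → Correct θ Tθ → Correct (cnt q z θ) (trCnt q z θ Tθ a d)
    correct-cnt q z θ Tθ (closed _) _ tests correctθ ρ ρA m@(st , _) = begin
      sat G ρ (sel G ρ (node test (leaf TT) (leaf FF)))  ≡⟨ sat-flag ρ test ⟩
      sat G ρ test                                      ≡⟨ sat-toFm G ρ (mapL (relY q z) Tθ) ⟩
      sat G ρ (sel G ρ (mapL (relY q z) Tθ))             ≡⟨ cong (sat G ρ) (sel-mapL G ρ (relY q z) Tθ) ⟩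
      sat G ρ (relY q z (sel G ρ Tθ))                    ≡⟨ sat-anchored q z θ Tθ k ρ ρA tests correctθ m y∈A
                                                             (param≢tr z ℕP.≤-refl) (ℕP.<⇒≢ (ℕP.n<1+n k)) ⟩
      sat H ρA (cnt q z θ)                              ∎
      where
      open ≡-Reasoning
      test : Fm C
      test = toFm (mapL (relY q z) Tθ)
      y∈A : T (A (ρ k))
      y∈A = subst (T ∘ A) (sym (standard-y st)) v∈A
    correct-cnt q z θ Tθ (anchored r fr@(cnt′ _ r≢z)) (yes _) tests correctθ ρ ρA m =
      trans (cong (sat G ρ) (sel-mapL G ρ (relIn q z r) Tθ))
            (sat-anchored q z θ Tθ (tr r) ρ ρA tests correctθ m (anchor-in-A m fr)
                          (r≢z ∘ tr-injective) (ℕP.<⇒≢ (s<tr r) ∘ sym))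
    correct-cnt q z θ Tθ (anchored r fr) (no z∉θ) tests correctθ ρ ρA m =
      trans (cong (sat G ρ) (sel-mapL G ρ (relOut q z r) Tθ)) (sat-vacuous q z θ Tθ r ρ ρA correctθ m fr z∉θ)

    correct : ∀ χ → Width ℓ χ → Correct χ (Tr χ)
    correct (eq x y)    _ ρ ρA (_ , match) rewrite match x eq₁ | match y eq₂ = emb-≟ A (ρA x) (ρA y)
    correct (edge x y)  _ ρ ρA (_ , match) rewrite match x edge₁ | match y edge₂ = refl
    correct (col c x y) _ ρ ρA (_ , match) rewrite match x col₁ | match y col₂ = refl
    correct (neg χ) (_ , wd) ρ ρA (st , match) =
      trans (cong (sat G ρ) (sel-mapL G ρ neg (Tr χ))) (cong not (correct χ wd ρ ρA (st , λ z → match z ∘ neg′)))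
    correct (or χ χ′) (_ , wd , wd′) ρ ρA (st , match) =
      trans (cong (sat G ρ) (sel-graft G ρ (Tr χ) (Tr χ′)))
            (cong₂ _∨_ (correct χ wd ρ ρA (st , λ z → match z ∘ orˡ)) (correct χ′ wd′ ρ ρA (st , λ z → match z ∘ orʳ)))
    correct (cnt q z θ) (_ , wd) =
      correct-cnt q z θ (Tr θ) (anchor (cnt q z θ)) (free? θ z) (allC-weaken (Tr θ) proj₂ (proj₁ (wf θ wd))) (correct θ wd)

module Construction {C : ℕ} (k n ℓ w : ℕ) (3≤ℓ : 3 ≤ ℓ) (k+ℓ≤w : k + ℓ ≤ w)
    (ψ : Fm C) (wψ : Width ℓ ψ) (sψ : Sentence ψ)
    (φ : Fm C) (wφ : Width w φ) (fφ : FreeAmong (suc k) φ) where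
  open Relativisation k n φ
  open WellFormed ℓ w 3≤ℓ k+ℓ≤w wφ fφ

  ψ̃ : Fm C
  ψ̃ = and (neg φ) (toFm (Tr ψ))

  -- As ψ is a sentence, the leaves of Tr ψ only mention x̄.
  sentence-leaf : ∀ {f} → Leaf ψ f → Cond f
  sentence-leaf (wd , scoped) = wd , λ x fx → case scoped x fx of λ
    { (param x<k) → there (∈-upTo⁺ x<k)
    ; (image fz)  → ⊥-elim (sψ _ fz) }

  ψ̃-fits : Fits w Lk ψ̃
  ψ̃-fits = fits-and room₁ (fits-neg room₁ (wφ , λ z → params ∘ fφ z))
    (fits-toFm room₁ (Tr ψ) (proj₁ (wf ψ wψ)) (allL-weaken (Tr ψ) sentence-leaf (proj₂ (wf ψ wψ))))

  ψ̃-free : FreeAmong (suc k) ψ̃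
  ψ̃-free z = Lk-params ∘ proj₂ ψ̃-fits z

  module _ (G : Graph C) (|G|≤n : N G ≤ n) (u : Fin k → V G) (v : V G) where
    open GuardSemantics fφ G u using (reached; reached-component)

    relativised : ∀ A (v∉U : ¬ Holds G k φ u v) → IsComponent G (λ t → ¬ Holds G k φ u t) v A →
      ∀ ρA → sat G (env k u v) (toFm (Tr ψ)) ≡ sat (induced G A) ρA ψ
    relativised A v∉U isComp ρA = trans (sat-toFm G (env k u v) (Tr ψ))
      (correct ψ wψ (env k u v) ρA ((λ _ _ → refl) , λ z fz → ⊥-elim (sψ z fz)))
      where open Correctness ℓ w 3≤ℓ k+ℓ≤w wφ fφ G |G|≤n u v A v∉U isComp

    ComponentModels : Set
    ComponentModels = (¬ Holds G k φ u v) × ∃ λ (A : V G → Bool) →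
      IsComponent G (λ t → ¬ Holds G k φ u t) v A × Models (induced G A) ψ

    ψ̃-correct : Holds G k ψ̃ u v ⇔ ComponentModels
    ψ̃-correct = mk⇔ to from
      where
      sat-ψ̃ : sat G (env k u v) ψ̃ ≡ (not (sat G (env k u v) φ) ∧ sat G (env k u v) (toFm (Tr ψ)))
      sat-ψ̃ = sat-and G (env k u v) (neg φ) (toFm (Tr ψ))
      to : Holds G k ψ̃ u v → ComponentModels
      to holds with T-∧⁻ (subst T sat-ψ̃ holds)
      ... | ¬φ , trψ = v∉U , reached n v , isComp , λ ρA → subst T (relativised _ v∉U isComp ρA) trψ
        where
        v∉U : ¬ Holds G k φ u v
        v∉U = T-not⁻ ¬φ
        isComp : IsComponent G (λ t → ¬ Holds G k φ u t) v (reached n v)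
        isComp = reached-component n |G|≤n v
      from : ComponentModels → Holds G k ψ̃ u v
      from (v∉U , A , isComp , models) = subst T (sym sat-ψ̃)
        (T-∧⁺ (T-not⁺ v∉U) (subst T (sym (relativised A v∉U isComp ρA)) (models ρA)))
        where
        ρA : Var → V (induced G A)
        ρA _ = proj₁ (emb-onto A v (proj₂ (isComp v) (here v∉U)))

lemma3p8 : ∀ {C : ℕ} (k n ℓ m : ℕ) → 1 ≤ n → 3 ≤ ℓ → 1 ≤ m →
    (ψ : Fm C) → Width ℓ ψ → Sentence ψ →
    (φ : Fm C) → Width m φ → FreeAmong (suc k) φ →
    Σ (Fm C) λ ψ̃ → Width ((k + ℓ) ⊔ m) ψ̃ × FreeAmong (suc k) ψ̃ ×
      ((G : Graph C) → N G ≤ n → (u : Fin k → V G) (v : V G) →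
        (Holds G k ψ̃ u v
          ⇔ ((¬ Holds G k φ u v)
             × ∃ λ (A : V G → Bool) →
                 IsComponent G (λ w → ¬ Holds G k φ u w) v A
                 × Models (induced G A) ψ)))
lemma3p8 k n ℓ m _ 3≤ℓ _ ψ wψ sψ φ wφ fφ = ψ̃ , proj₁ ψ̃-fits , ψ̃-free , ψ̃-correct
  where
  open Construction k n ℓ ((k + ℓ) ⊔ m) 3≤ℓ (ℕP.m≤m⊔n (k + ℓ) m)
                    ψ wψ sψ φ (width-mono φ (ℕP.m≤n⊔m (k + ℓ) m) wφ) fφ
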